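{- For all integers $r\geq 2$ and $k\geq 3$, we have $P_r(k) > (k-1)r$.
   Context: All graphs are finite and simple; $K_k$ denotes the complete graph on $k$ vertices. A colour pattern on a vertex set $V$ is a sequence $G_1,\ldots,G_r$ of pairwise edge-disjoint graphs all with vertex set $V$; it is $K_{k+1}$-free if no $G_i$ contains $K_{k+1}$. Given a colour pattern $G_1,\dots,G_r$ on $V$ and a colouring $c:V\to[r]$, a strongly monochromatic $K_k$ is a set of $k$ vertices all of the same colour $i$ under $c$ which forms a clique in $G_i$. $P_r(k)$ is the smallest integer $n$ such that there exists a $K_{k+1}$-free colour pattern $G_1,\ldots,G_r$ on an $n$-element vertex set $V$ such that every colouring $V\to[r]$ contains a strongly monochromatic $K_k$. -}

module Defs where

open import Data.Nat using (ℕ; suc)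
open import Data.Fin using (Fin)
open import Data.Bool using (Bool; true; false)
open import Data.Product using (Σ; _×_; ∃)
open import Relation.Binary.PropositionalEquality using (_≡_; _≢_)
open import Relation.Nullary using (¬_)
open import Function.Definitions using (Injective)

record Graph (n : ℕ) : Set where
  field
    adj   : Fin n → Fin n → Bool
    sym   : ∀ u v → adj u v ≡ adj v u
    irrefl : ∀ u → adj u u ≡ false
open Graph public

IsClique : ∀ {n} (G : Graph n) (k : ℕ) → (Fin k → Fin n) → Set
IsClique G k f = Injective _≡_ _≡_ f × (∀ a b → a ≢ b → adj G (f a) (f b) ≡ true)

ContainsK : ∀ {n} (G : Graph n) (k : ℕ) → Set
ContainsK {n} G k = Σ (Fin k → Fin n) (IsClique G k)

record ColourPattern (r n : ℕ) : Set where
  field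
    graph    : Fin r → Graph n
    disjoint : ∀ i j → i ≢ j → ∀ u v →
               adj (graph i) u v ≡ true → adj (graph j) u v ≡ false
open ColourPattern public

KFree : ∀ {r n} → ColourPattern r n → ℕ → Set
KFree P k = ∀ i → ¬ ContainsK (graph P i) (suc k)

StronglyMonoK : ∀ {r n} → ColourPattern r n → (Fin n → Fin r) → ℕ → Set
StronglyMonoK {r} {n} P c k =
  Σ (Fin r) λ i → Σ (Fin k → Fin n) λ f →
    (∀ a → c (f a) ≡ i) × IsClique (graph P i) k f

-- There is a K_{k+1}-free colour pattern with r colours on an n-element vertex
-- set such that every colouring contains a strongly monochromatic K_k.
-- P_r(k) is the least n with Forcing r k n.
Forcing : ℕ → ℕ → ℕ → Set
Forcing r k n = Σ (ColourPattern r n) λ P →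
  KFree P k × (∀ (c : Fin n → Fin r) → StronglyMonoK P c k)

-- Split the n ≤ (k − 1) r vertices into r blocks of at most k − 1 vertices and
-- give the vertices of block i colour i. Every colour class then has fewer than
-- k vertices, so no colouring of this kind contains a monochromatic k-set at
-- all, let alone a strongly monochromatic K_k.
module Submission where

open import Defs hiding (sym)
open import Data.Nat using (ℕ; suc; _≤_; _*_; _∸_; s≤s)
open import Data.Nat.Properties using (n<1+n; ≤-trans; ≤-reflexive; *-comm)
open import Data.Fin using (Fin; inject≤; remQuot; combine)
open import Data.Fin.Properties using (pigeonhole; <⇒≢; inject≤-injective; combine-remQuot)
open import Data.Product using (_×_; _,_; proj₁; proj₂; uncurry)
open import Function.Definitions using (Injective)
open import Relation.Nullary using (¬_)
open import Relation.Binary.PropositionalEquality using (_≡_; trans; sym; cong; cong₂)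

classesEmbed⇒¬StronglyMonoK :
  ∀ {r n d} (P : ColourPattern r n) (c : Fin n → Fin r) (s : Fin n → Fin d) →
  Injective _≡_ _≡_ (λ v → c v , s v) → ¬ StronglyMonoK P c (suc d)
classesEmbed⇒¬StronglyMonoK {d = d} P c s embed (_ , f , mono , f-injective , _)
  with pigeonhole (n<1+n d) (λ a → s (f a))
... | a , b , a<b , same-slot =
  <⇒≢ a<b (f-injective (embed (cong₂ _,_ same-colour same-slot)))
  where
  same-colour : c (f a) ≡ c (f b)
  same-colour = trans (mono a) (sym (mono b))

remQuot-injective : ∀ {r} d → Injective _≡_ _≡_ (remQuot {r} d)
remQuot-injective {r} d {u} {v} eq =
  trans (sym (combine-remQuot {r} d u))
        (trans (cong (uncurry combine) eq) (combine-remQuot {r} d v))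

module _ {n} (r d : ℕ) (n≤rd : n ≤ r * d) where

  block : Fin n → Fin r × Fin d
  block v = remQuot d (inject≤ v n≤rd)

  block-injective : Injective _≡_ _≡_ block
  block-injective eq = inject≤-injective n≤rd n≤rd _ _ (remQuot-injective d eq)

lemma3p1 : ∀ (r k : ℕ) → 2 ≤ r → 3 ≤ k →
             ∀ (n : ℕ) → n ≤ (k ∸ 1) * r → ¬ Forcing r k n
lemma3p1 r (suc d) _ (s≤s _) n n≤dr (P , _ , forces) =
  classesEmbed⇒¬StronglyMonoK P colour slot (block-injective r d n≤rd) (forces colour)
  where
  n≤rd : n ≤ r * d
  n≤rd = ≤-trans n≤dr (≤-reflexive (*-comm d r))

  colour : Fin n → Fin r
  colour v = proj₁ (block r d n≤rd v)

  slot : Fin n → Fin d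
  slot v = proj₂ (block r d n≤rd v)
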